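{- Let $P\in\Lambda_1(3,n)$. Then there exist $Q_1,\dots,Q_n\in\Lambda_2(3,n)$ with $P=Q_1+\cdots+Q_n$ if and only if the Latin square $\mathcal H(P)$ has an orthogonal mate.
   Context: Let $I_n=\{1,\dots,n\}$ and $M(3,n)$ the set of maps $I_n^3\to\mathbb R$. A line (resp. plane) is a set of positions obtained by fixing two coordinates (resp. one coordinate). $\Lambda_1(3,n)$ is the set of $(0,1)$-matrices in $M(3,n)$ with exactly one $1$ in each line; $\Lambda_2(3,n)$ is the set of $(0,1)$-matrices in $M(3,n)$ with exactly one $1$ in each plane. For $P\in\Lambda_1(3,n)$, $\mathcal H(P)$ is the Latin square with $\mathcal H(P)(i,j)=k$ iff $P(i,j,k)=1$. An orthogonal mate of a Latin square $L$ of order $n$ is a Latin square $L'$ of order $n$ such that the $n^2$ ordered pairs $(L(i,j),L'(i,j))$ are all distinct. -}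

module Defs where

open import Data.Nat using (ℕ; zero; suc; _+_)
open import Data.Fin using (Fin)
open import Data.Product using (Σ; _×_; _,_; proj₁; ∃-syntax)
open import Data.Sum using (_⊎_)
open import Function.Definitions using (Injective)
open import Relation.Binary.PropositionalEquality using (_≡_)

-- M(3,n): maps I_n^3 → values.  Since every matrix in the statement is a
-- (0,1)-matrix or a finite sum of such, we take natural-number entries.
M3 : ℕ → Set
M3 n = Fin n → Fin n → Fin n → ℕ

IsZeroOne : ∀ {n} → M3 n → Set
IsZeroOne {n} A = ∀ i j k → (A i j k ≡ 0) ⊎ (A i j k ≡ 1)

ExactlyOneOne : ∀ {n} → (Fin n → ℕ) → Set
ExactlyOneOne {n} f = Σ (Fin n) λ x → (f x ≡ 1) × (∀ y → f y ≡ 1 → y ≡ x)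

Λ₁ : ∀ {n} → M3 n → Set
Λ₁ {n} A = IsZeroOne A
  × (∀ j k → ExactlyOneOne (λ i → A i j k))
  × (∀ i k → ExactlyOneOne (λ j → A i j k))
  × (∀ i j → ExactlyOneOne (λ k → A i j k))

ExactlyOneOne² : ∀ {n} → (Fin n → Fin n → ℕ) → Set
ExactlyOneOne² {n} f =
  Σ (Fin n × Fin n) λ { (x , y) →
    (f x y ≡ 1) × (∀ x' y' → f x' y' ≡ 1 → (x' , y') ≡ (x , y)) }

Λ₂ : ∀ {n} → M3 n → Set
Λ₂ {n} A = IsZeroOne A
  × (∀ i → ExactlyOneOne² (λ j k → A i j k))
  × (∀ j → ExactlyOneOne² (λ i k → A i j k))
  × (∀ k → ExactlyOneOne² (λ i j → A i j k))

sumM : ∀ {n} (m : ℕ) → (Fin m → M3 n) → M3 n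
sumM zero Q i j k = 0
sumM (suc m) Q i j k = Q Fin.zero i j k + sumM m (λ t → Q (Fin.suc t)) i j k

LatinSquare : ℕ → Set
LatinSquare n = Fin n → Fin n → Fin n

IsLatin : ∀ {n} → LatinSquare n → Set
IsLatin {n} L = (∀ i → Injective _≡_ _≡_ (λ j → L i j))
              × (∀ j → Injective _≡_ _≡_ (λ i → L i j))

-- 𝓗(P)(i,j) = k iff P(i,j,k) = 1
𝓗 : ∀ {n} (P : M3 n) → Λ₁ P → LatinSquare n
𝓗 P (_ , _ , _ , h) i j = proj₁ (h i j)

IsOrthogonalMate : ∀ {n} → LatinSquare n → LatinSquare n → Set
IsOrthogonalMate {n} L L' = IsLatin L' ×
  (∀ i j i' j' → L i j ≡ L i' j' → L' i j ≡ L' i' j' → (i , j) ≡ (i' , j'))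

HasOrthogonalMate : ∀ {n} → LatinSquare n → Set
HasOrthogonalMate {n} L = ∃[ L' ] IsOrthogonalMate L L'

-- Write L = 𝓗(P), so that P(i,j,k) = [L(i,j) = k]. In a decomposition P = Q₁ + ⋯ + Qₙ
-- every 1 of P lies in exactly one layer Q_t; recording that layer as L'(i,j) = t gives
-- a square whose rows and columns are injective because the planes i and j of Q_t contain
-- a single 1, and which is orthogonal to L because the plane k of Q_t contains a single 1.
-- Conversely, an orthogonal mate L' yields the layers Q_t(i,j,k) = [L(i,j) = k ∧ L'(i,j) = t];
-- injective maps of a finite set to itself are onto, so every plane of Q_t is hit.
module Submission where

open import Defs
open import Level using (Level)
open import Data.Nat using (ℕ; zero; suc; _+_)
open import Data.Nat.Properties
  using (+-0-commutativeMonoid; n<1+n; 0≢1+n; suc-injective; m+n≡0⇒m≡0; m+n≡0⇒n≡0)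
open import Data.Fin using (Fin; zero; suc; punchIn; punchOut)
open import Data.Fin.Properties
  using (_≟_; any?; punchOut-injective; punchInᵢ≢i; <⇒notInjective; *↔×)
open import Data.Bool using (if_then_else_)
open import Data.Product using (Σ; _×_; _,_; proj₁; proj₂)
open import Data.Sum using (_⊎_; inj₁; inj₂)
open import Data.Empty using (⊥-elim)
open import Function using (_∘_; Inverse; _↔_; _⇔_; mk⇔)
open import Function.Definitions using (Injective; StrictlySurjective)
open import Function.Properties.Inverse using (↔-sym)
open import Relation.Nullary using (Dec; yes; no; does; ¬_; contradiction)
open import Relation.Nullary.Decidable using (_×-dec_)
open import Relation.Binary.PropositionalEquality
open import Algebra.Properties.CommutativeMonoid.Sum +-0-commutativeMonoid
  using (sum; sum-cong-≗; sum-replicate-zero; sum-remove)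

private
  variable
    a : Level
    A : Set a
    m : ℕ

injective⇒strictlySurjective : {f : Fin m → Fin m} →
  Injective _≡_ _≡_ f → StrictlySurjective _≡_ f
injective⇒strictlySurjective {zero}  f-inj ()
injective⇒strictlySurjective {suc m} {f} f-inj y with any? (λ x → f x ≟ y)
... | yes hit = hit
... | no  miss = ⊥-elim (<⇒notInjective (n<1+n m) avoid-y-injective)
  where
  y≢f : ∀ x → y ≢ f x
  y≢f x y≡fx = miss (x , sym y≡fx)

  avoid-y : Fin (suc m) → Fin m
  avoid-y x = punchOut (y≢f x)

  avoid-y-injective : Injective _≡_ _≡_ avoid-y
  avoid-y-injective {x} {x′} = f-inj ∘ punchOut-injective (y≢f x) (y≢f x′)

finite-injective⇒strictlySurjective : A ↔ Fin m → {f : A → A} →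
  Injective _≡_ _≡_ f → StrictlySurjective _≡_ f
finite-injective⇒strictlySurjective e {f} f-inj y = from x , (begin
    f (from x)              ≡⟨ strictlyInverseʳ (f (from x)) ⟨
    from (to (f (from x)))  ≡⟨ cong from g[x]≡to[y] ⟩
    from (to y)             ≡⟨ strictlyInverseʳ y ⟩
    y                       ∎)
  where
  open Inverse e
  open ≡-Reasoning

  g : Fin _ → Fin _
  g = to ∘ f ∘ from

  g-injective : Injective _≡_ _≡_ g
  g-injective {x} {x′} g[x]≡g[x′] = begin
    x               ≡⟨ strictlyInverseˡ x ⟨
    to (from x)     ≡⟨ cong to (f-inj (begin
      f (from x)        ≡⟨ strictlyInverseʳ (f (from x)) ⟨
      from (g x)        ≡⟨ cong from g[x]≡g[x′] ⟩
      from (g x′)       ≡⟨ strictlyInverseʳ (f (from x′)) ⟩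
      f (from x′)       ∎)) ⟩
    to (from x′)    ≡⟨ strictlyInverseˡ x′ ⟩
    x′              ∎

  x : Fin _
  x = proj₁ (injective⇒strictlySurjective g-injective (to y))

  g[x]≡to[y] : g x ≡ to y
  g[x]≡to[y] = proj₂ (injective⇒strictlySurjective g-injective (to y))

𝟙 : Dec A → ℕ
𝟙 a? = if does a? then 1 else 0

𝟙-zeroOne : (a? : Dec A) → 𝟙 a? ≡ 0 ⊎ 𝟙 a? ≡ 1
𝟙-zeroOne (yes _) = inj₂ refl
𝟙-zeroOne (no  _) = inj₁ refl

𝟙-yes : (a? : Dec A) → A → 𝟙 a? ≡ 1
𝟙-yes (yes _) _ = refl
𝟙-yes (no ¬a) a = contradiction a ¬a

𝟙-no : (a? : Dec A) → ¬ A → 𝟙 a? ≡ 0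
𝟙-no (yes a) ¬a = contradiction a ¬a
𝟙-no (no  _) _  = refl

𝟙≡1⇒ : (a? : Dec A) → 𝟙 a? ≡ 1 → A
𝟙≡1⇒ (yes a) _ = a

sum-𝟙-≟ : (s : Fin m) → sum (λ t → 𝟙 (s ≟ t)) ≡ 1
sum-𝟙-≟ {suc m} s = begin
  sum (λ t → 𝟙 (s ≟ t))
    ≡⟨ sum-remove {i = s} (λ t → 𝟙 (s ≟ t)) ⟩
  𝟙 (s ≟ s) + sum (λ t → 𝟙 (s ≟ punchIn s t))
    ≡⟨ cong₂ _+_ (𝟙-yes (s ≟ s) refl) (sum-cong-≗ {m} off-diagonal) ⟩
  1 + sum {m} (λ _ → 0)
    ≡⟨ cong suc (sum-replicate-zero m) ⟩
  1 ∎
  where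
  open ≡-Reasoning
  off-diagonal : ∀ t → 𝟙 (s ≟ punchIn s t) ≡ 0
  off-diagonal t = 𝟙-no (s ≟ punchIn s t) (punchInᵢ≢i s t ∘ sym)

sum-𝟙-×-≟ : (a? : Dec A) (s : Fin m) → sum (λ t → 𝟙 (a? ×-dec s ≟ t)) ≡ 𝟙 a?
sum-𝟙-×-≟         (yes _) s = sum-𝟙-≟ s
sum-𝟙-×-≟ {m = m} (no  _) s = sum-replicate-zero m

sum≡0⇒≡0 : {f : Fin m → ℕ} → sum f ≡ 0 → ∀ t → f t ≡ 0
sum≡0⇒≡0 {f = f} Σf≡0 zero    = m+n≡0⇒m≡0 (f zero) Σf≡0
sum≡0⇒≡0 {f = f} Σf≡0 (suc t) = sum≡0⇒≡0 (m+n≡0⇒n≡0 (f zero) Σf≡0) t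

zeroOne-sum≡1⇒exactlyOneOne : {f : Fin m → ℕ} →
  (∀ t → f t ≡ 0 ⊎ f t ≡ 1) → sum f ≡ 1 → ExactlyOneOne f
zeroOne-sum≡1⇒exactlyOneOne {suc m} {f} zeroOne Σf≡1 with zeroOne zero
... | inj₁ f₀≡0 =
  let t , f[t]≡1 , unique = zeroOne-sum≡1⇒exactlyOneOne (zeroOne ∘ suc)
                              (subst (λ v → v + sum (f ∘ suc) ≡ 1) f₀≡0 Σf≡1)
  in suc t , f[t]≡1 , λ where
       zero    f₀≡1 → contradiction (trans (sym f₀≡0) f₀≡1) 0≢1+n
       (suc u) f[u]≡1 → cong suc (unique u f[u]≡1)
... | inj₂ f₀≡1 = zero , f₀≡1 , λ where
       zero    _      → refl
       (suc u) f[u]≡1 → contradiction (trans (sym (sum≡0⇒≡0 rest≡0 u)) f[u]≡1) 0≢1+n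
  where
  rest≡0 : sum (f ∘ suc) ≡ 0
  rest≡0 = suc-injective (subst (λ v → v + sum (f ∘ suc) ≡ 1) f₀≡1 Σf≡1)

sumM≡sum : ∀ {n} m (Q : Fin m → M3 n) i j k → sumM m Q i j k ≡ sum (λ t → Q t i j k)
sumM≡sum zero    Q i j k = refl
sumM≡sum (suc m) Q i j k = cong (Q zero i j k +_) (sumM≡sum m (Q ∘ suc) i j k)

exactlyOneOne²-unique : ∀ {n} {f : Fin n → Fin n → ℕ} → ExactlyOneOne² f →
  ∀ {x y x′ y′} → f x y ≡ 1 → f x′ y′ ≡ 1 → (x , y) ≡ (x′ , y′)
exactlyOneOne²-unique (_ , _ , unique) f[x,y]≡1 f[x′,y′]≡1 =
  trans (unique _ _ f[x,y]≡1) (sym (unique _ _ f[x′,y′]≡1))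

𝟙-exactlyOneOne² : ∀ {n} {R : Fin n → Fin n → Set} (R? : ∀ x y → Dec (R x y)) x y →
  R x y → (∀ x′ y′ → R x′ y′ → (x′ , y′) ≡ (x , y)) → ExactlyOneOne² (λ x y → 𝟙 (R? x y))
𝟙-exactlyOneOne² R? x y r unique =
  (x , y) , 𝟙-yes (R? x y) r , λ x′ y′ → unique x′ y′ ∘ 𝟙≡1⇒ (R? x′ y′)

Λ₁⇒≡𝟙 : ∀ {n} {P : M3 n} (hP : Λ₁ P) i j k → P i j k ≡ 𝟙 (𝓗 P hP i j ≟ k)
Λ₁⇒≡𝟙 {P = P} hP@(zeroOne , _ , _ , lines) i j k with 𝓗 P hP i j ≟ k | zeroOne i j k
... | yes refl | _         = proj₁ (proj₂ (lines i j))
... | no  _    | inj₁ P≡0 = P≡0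
... | no  L≢k  | inj₂ P≡1 = contradiction (sym (proj₂ (proj₂ (lines i j)) k P≡1)) L≢k

Λ₂-Decomposition : ∀ {n} → M3 n → Set
Λ₂-Decomposition {n} P =
  Σ (Fin n → M3 n) λ Q → (∀ t → Λ₂ (Q t)) × (∀ i j k → P i j k ≡ sumM n Q i j k)

Λ₂-Decomposition⇒mate : ∀ {n} {P : M3 n} (hP : Λ₁ P) →
  Λ₂-Decomposition P → HasOrthogonalMate (𝓗 P hP)
Λ₂-Decomposition⇒mate {n} {P} hP (Q , Q∈Λ₂ , P≡ΣQ) = L′ , (L′-rows , L′-cols) , orthogonal
  where
  open ≡-Reasoning

  L : LatinSquare n
  L = 𝓗 P hP

  plane₁ : ∀ t i → ExactlyOneOne² (λ j k → Q t i j k)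
  plane₁ t = proj₁ (proj₂ (Q∈Λ₂ t))

  plane₂ : ∀ t j → ExactlyOneOne² (λ i k → Q t i j k)
  plane₂ t = proj₁ (proj₂ (proj₂ (Q∈Λ₂ t)))

  plane₃ : ∀ t k → ExactlyOneOne² (λ i j → Q t i j k)
  plane₃ t = proj₂ (proj₂ (proj₂ (Q∈Λ₂ t)))

  layer : ∀ i j → ExactlyOneOne (λ t → Q t i j (L i j))
  layer i j = zeroOne-sum≡1⇒exactlyOneOne (λ t → proj₁ (Q∈Λ₂ t) i j (L i j)) (begin
    sum (λ t → Q t i j (L i j))  ≡⟨ sumM≡sum n Q i j (L i j) ⟨
    sumM n Q i j (L i j)         ≡⟨ P≡ΣQ i j (L i j) ⟨
    P i j (L i j)                ≡⟨ Λ₁⇒≡𝟙 hP i j (L i j) ⟩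
    𝟙 (L i j ≟ L i j)            ≡⟨ 𝟙-yes (L i j ≟ L i j) refl ⟩
    1                            ∎)

  L′ : LatinSquare n
  L′ i j = proj₁ (layer i j)

  covers : ∀ {t k} i j → L′ i j ≡ t → L i j ≡ k → Q t i j k ≡ 1
  covers i j refl refl = proj₁ (proj₂ (layer i j))

  L′-rows : ∀ i → Injective _≡_ _≡_ (L′ i)
  L′-rows i {j} {j′} e = cong proj₁ (exactlyOneOne²-unique (plane₁ (L′ i j) i)
    (covers i j refl refl) (covers i j′ (sym e) refl))

  L′-cols : ∀ j → Injective _≡_ _≡_ (λ i → L′ i j)
  L′-cols j {i} {i′} e = cong proj₁ (exactlyOneOne²-unique (plane₂ (L′ i j) j)
    (covers i j refl refl) (covers i′ j (sym e) refl))

  orthogonal : ∀ i j i′ j′ → L i j ≡ L i′ j′ → L′ i j ≡ L′ i′ j′ → (i , j) ≡ (i′ , j′)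
  orthogonal i j i′ j′ e₁ e₂ = exactlyOneOne²-unique (plane₃ (L′ i j) (L i j))
    (covers i j refl refl) (covers i′ j′ (sym e₂) (sym e₁))

mate⇒Λ₂-Decomposition : ∀ {n} {P : M3 n} (hP : Λ₁ P) →
  HasOrthogonalMate (𝓗 P hP) → Λ₂-Decomposition P
mate⇒Λ₂-Decomposition {n} {P} hP (L′ , (L′-rows , L′-cols) , orthogonal) =
  Q , (λ t → Q-zeroOne t , plane₁ t , plane₂ t , plane₃ t) , P≡ΣQ
  where
  open ≡-Reasoning

  L : LatinSquare n
  L = 𝓗 P hP

  in-layer? : ∀ t i j k → Dec (L i j ≡ k × L′ i j ≡ t)
  in-layer? t i j k = L i j ≟ k ×-dec L′ i j ≟ t

  Q : Fin n → M3 n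
  Q t i j k = 𝟙 (in-layer? t i j k)

  Q-zeroOne : ∀ t → IsZeroOne (Q t)
  Q-zeroOne t i j k = 𝟙-zeroOne (in-layer? t i j k)

  plane₁ : ∀ t i → ExactlyOneOne² (λ j k → Q t i j k)
  plane₁ t i with j , refl ← injective⇒strictlySurjective (L′-rows i) t =
    𝟙-exactlyOneOne² (in-layer? t i) j (L i j) (refl , refl)
      λ { j′ _ (refl , e) → cong (λ j → j , L i j) (L′-rows i e) }

  plane₂ : ∀ t j → ExactlyOneOne² (λ i k → Q t i j k)
  plane₂ t j with i , refl ← injective⇒strictlySurjective (L′-cols j) t =
    𝟙-exactlyOneOne² (λ i k → in-layer? t i j k) i (L i j) (refl , refl)
      λ { i′ _ (refl , e) → cong (λ i → i , L i j) (L′-cols j e) }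

  pair : Fin n × Fin n → Fin n × Fin n
  pair (i , j) = L i j , L′ i j

  pair-injective : Injective _≡_ _≡_ pair
  pair-injective {i , j} {i′ , j′} e = orthogonal i j i′ j′ (cong proj₁ e) (cong proj₂ e)

  plane₃ : ∀ t k → ExactlyOneOne² (λ i j → Q t i j k)
  plane₃ t k with (i , j) , refl ←
      finite-injective⇒strictlySurjective (↔-sym *↔×) pair-injective (k , t) =
    𝟙-exactlyOneOne² (λ i j → in-layer? t i j k) i j (refl , refl)
      λ { i′ j′ (e₁ , e₂) → orthogonal i′ j′ i j e₁ e₂ }

  P≡ΣQ : ∀ i j k → P i j k ≡ sumM n Q i j k
  P≡ΣQ i j k = begin
    P i j k                  ≡⟨ Λ₁⇒≡𝟙 hP i j k ⟩
    𝟙 (L i j ≟ k)            ≡⟨ sum-𝟙-×-≟ (L i j ≟ k) (L′ i j) ⟨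
    sum (λ t → Q t i j k)    ≡⟨ sumM≡sum n Q i j k ⟨
    sumM n Q i j k           ∎

lemma3p1 : (n : ℕ) (P : M3 n) (hP : Λ₁ P) →
    (Σ (Fin n → M3 n) (λ Q → (∀ t → Λ₂ (Q t)) × (∀ i j k → P i j k ≡ sumM n Q i j k)))
    ⇔ HasOrthogonalMate (𝓗 P hP)
lemma3p1 n P hP = mk⇔ (Λ₂-Decomposition⇒mate hP) (mate⇒Λ₂-Decomposition hP)
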